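{- Let $G$ be a graph on $n$ vertices. Then Dominator can win the Maker–Breaker domination game on $G\square K_2$ in at most $n$ moves. If Dominator has a winning strategy in the game on $G$ both as the first and as the second player, then $\gamma_{MB}(G\square K_2)\leq \min\{\gamma_{MB}(G)+\gamma'_{MB}(G),\ n\}$ and $\gamma'_{MB}(G\square K_2)\leq\min\{2\gamma'_{MB}(G),\ n\}$.
   Context: $G\square K_2$ denotes the Cartesian product of $G$ with the complete graph on two vertices. In the Maker–Breaker domination game on a graph $G$, two players, Dominator and Staller, alternately claim previously unclaimed vertices of $G$. Dominator wins if the set of vertices he claims becomes a dominating set of $G$ (every vertex not in it has a neighbour in it); Staller wins if she claims some vertex together with all of its neighbours. In the $D$-game Dominator moves first, in the $S$-game Staller moves first. $\gamma_{MB}(G)$ is the minimum number of moves Dominator needs to win the $D$-game on $G$ against optimal play by Staller (who tries to postpone his win), and $\gamma'_{MB}(G)$ the analogous quantity for the $S$-game. -}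

module Defs where

open import Data.Nat using (ℕ; zero; suc; _+_; _<_)
open import Data.Fin using (Fin; splitAt; _≟_)
open import Data.Bool using (Bool; true; false; if_then_else_)
open import Data.Sum using (_⊎_; inj₁; inj₂)
open import Data.Product using (_×_; ∃; ∃-syntax)
open import Data.Empty using (⊥)
open import Relation.Nullary using (¬_)
open import Relation.Nullary.Decidable using (⌊_⌋)
open import Relation.Binary.PropositionalEquality using (_≡_)

Adj : ℕ → Set
Adj n = Fin n → Fin n → Bool

record SimpleGraph (n : ℕ) : Set where
  field
    adj    : Adj n
    sym    : ∀ u v → adj u v ≡ adj v u
    irrefl : ∀ v → adj v v ≡ false
open SimpleGraph public

-- Cartesian product with K₂: vertex set Fin (n + n), the first n vertices
-- are layer 1 (copy (u,1)), the last n are layer 2 (copy (u,2)).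
-- (u,i) ~ (v,j)  iff  (i = j and u ~ v) or (u = v and i ≠ j).
_□K₂ : ∀ {n} → Adj n → Adj (n + n)
_□K₂ {n} a x y with splitAt n x | splitAt n y
... | inj₁ u | inj₁ v = a u v
... | inj₂ u | inj₂ v = a u v
... | inj₁ u | inj₂ v = ⌊ u ≟ v ⌋
... | inj₂ u | inj₁ v = ⌊ u ≟ v ⌋

data Cell : Set where
  free dom stal : Cell

Pos : ℕ → Set
Pos n = Fin n → Cell

start : ∀ {n} → Pos n
start _ = free

upd : ∀ {n} → Pos n → Fin n → Cell → Pos n
upd p v c w = if ⌊ w ≟ v ⌋ then c else p w

module Game {n : ℕ} (a : Adj n) where

  DomWins : Pos n → Set
  DomWins p = ∀ v → p v ≡ dom ⊎ ∃[ w ] (a v w ≡ true × p w ≡ dom)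

  StallerWins : Pos n → Set
  StallerWins p = ∃[ v ] (∀ w → (w ≡ v ⊎ a v w ≡ true) → p w ≡ stal)

  mutual
    -- WinD k p : Dominator to move in position p, and he can force a win
    -- using at most k further moves of his own.
    WinD : ℕ → Pos n → Set
    WinD k p = DomWins p ⊎ (¬ StallerWins p × WinD-move k p)

    WinD-move : ℕ → Pos n → Set
    WinD-move zero p = ⊥
    WinD-move (suc k) p = ∃[ v ] (p v ≡ free × WinS k (upd p v dom))

    WinS : ℕ → Pos n → Set
    WinS k p = DomWins p ⊎
               (¬ StallerWins p × (∀ v → p v ≡ free → WinD k (upd p v stal)))

IsγMB : ∀ {n} → Adj n → ℕ → Set
IsγMB a g = Game.WinD a g start × (∀ k → k < g → ¬ Game.WinD a k start)

IsγMB′ : ∀ {n} → Adj n → ℕ → Set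
IsγMB′ a g = Game.WinS a g start × (∀ k → k < g → ¬ Game.WinS a k start)

module Submission where

-- A play of G □ K₂ is analysed through its two layers L true and L false, each a
-- copy of G, joined by the perfect matching of twins  L b u ~ L (not b) u.
--
-- Part 1 (at most n moves): the pairing strategy. Dominator answers each Staller
-- move by claiming its twin, and otherwise claims a free vertex of layer true.
-- Every Dominator move claims a free vertex of layer true, so the number of such
-- vertices (a subset count) bounds the moves; when none is left, every twin pair
-- holds a Dominator vertex, which dominates G □ K₂.
--
-- Part 2 (the bounds via γ_MB and γ'_MB): Dominator plays optimal G-strategies on
-- the two layers independently, answering in the layer where Staller moved. This
-- needs two general facts about the game: winning is monotone under handing
-- Staller's vertices back to the board, and an S-game win within k moves is also
-- a D-game win within k moves. Finally, minimality of γ turns these strategies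
-- into the stated upper bounds.

open import Defs hiding (sym)
open import Data.Nat using (ℕ; zero; suc; s≤s; _+_; _*_; _≤_; _<_; _⊓_)
open import Data.Nat.Properties using (≤-trans; <-≤-trans; ≤-refl; ≤-reflexive; ⊓-glb; ≮⇒≥; m≤n+m; +-comm; +-identityʳ)
open import Data.Fin using (Fin; _≟_; _↑ˡ_; _↑ʳ_; splitAt; join)
open import Data.Fin.Properties using (any?; splitAt-↑ˡ; splitAt-↑ʳ; join-splitAt; ↑ˡ-injective; ↑ʳ-injective)
open import Data.Fin.Subset using (Subset; _∈_; _⊆_; ∣_∣)
open import Data.Fin.Subset.Properties using (p⊆q⇒∣p∣≤∣q∣; p⊂q⇒∣p∣<∣q∣; ∣p∣≤n)
open import Data.Vec using (tabulate)
open import Data.Vec.Properties using (lookup∘tabulate; lookup⇒[]=; []=⇒lookup)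
open import Data.Bool using (Bool; true; false; not)
open import Data.Bool.Properties using (not-involutive; not-¬) renaming (_≟_ to _≟ᵇ_)
open import Data.Sum using (_⊎_; inj₁; inj₂)
open import Data.Product using (_×_; _,_; proj₁; proj₂; ∃-syntax)
open import Data.Empty using (⊥; ⊥-elim)
open import Function using (_∘_)
open import Relation.Nullary using (¬_; yes; no; Dec; ¬?)
open import Relation.Nullary.Decidable using (⌊_⌋; _⊎-dec_; _×-dec_; decidable-stable)
open import Relation.Binary.PropositionalEquality
  using (_≡_; _≢_; _≗_; refl; sym; trans; cong; subst)

dom≢free : dom ≢ free
dom≢free ()

stal≢free : stal ≢ free
stal≢free ()

dom≢stal : dom ≢ stal
dom≢stal ()

cell-cases : (c : Cell) → c ≡ free ⊎ c ≡ dom ⊎ c ≡ stal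
cell-cases free = inj₁ refl
cell-cases dom  = inj₂ (inj₁ refl)
cell-cases stal = inj₂ (inj₂ refl)

upd-same : ∀ {m} (p : Pos m) v c → upd p v c v ≡ c
upd-same p v c with v ≟ v
... | yes _ = refl
... | no v≢v = ⊥-elim (v≢v refl)

upd-other : ∀ {m} (p : Pos m) v c {w} → w ≢ v → upd p v c w ≡ p w
upd-other p v c {w} w≢v with w ≟ v
... | yes w≡v = ⊥-elim (w≢v w≡v)
... | no _ = refl

upd-back : ∀ {m} (p : Pos m) v {c d} w → c ≢ d → upd p v c w ≡ d → p w ≡ d
upd-back p v w c≢d e with w ≟ v
... | yes _ = ⊥-elim (c≢d e)
... | no _ = e

upd-cell : ∀ {m} (p : Pos m) v {c} w → upd p v c w ≡ c → w ≡ v ⊎ p w ≡ c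
upd-cell p v w e with w ≟ v
... | yes w≡v = inj₁ w≡v
... | no _ = inj₂ e

upd-keeps : ∀ {m} (p : Pos m) {v} c {w d} → p v ≡ free → d ≢ free → p w ≡ d → upd p v c w ≡ d
upd-keeps p {v} c vf d≢free refl = upd-other p v c (λ { refl → d≢free vf })

-- The number of free vertices bounds the length of a strategy.

isFree : Cell → Bool
isFree free = true
isFree dom  = false
isFree stal = false

isFree-sound : ∀ c → isFree c ≡ true → c ≡ free
isFree-sound free _ = refl

freeSet : ∀ {m} → Pos m → Subset m
freeSet p = tabulate (isFree ∘ p)

∈freeSet : ∀ {m} (p : Pos m) {v} → p v ≡ free → v ∈ freeSet p
∈freeSet p {v} vf = lookup⇒[]= v _ (trans (lookup∘tabulate (isFree ∘ p) v) (cong isFree vf))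

∈freeSet⁻ : ∀ {m} (p : Pos m) {v} → v ∈ freeSet p → p v ≡ free
∈freeSet⁻ p {v} v∈ = isFree-sound (p v) (trans (sym (lookup∘tabulate (isFree ∘ p) v)) ([]=⇒lookup v∈))

nFree : ∀ {m} → Pos m → ℕ
nFree p = ∣ freeSet p ∣

-- q is reached from p by claiming vertices: whatever is free in q was free in p.
_↝_ : ∀ {m} → Pos m → Pos m → Set
p ↝ q = ∀ v → q v ≡ free → p v ≡ free

↝-upd : ∀ {m} (p : Pos m) v {c} → c ≢ free → p ↝ upd p v c
↝-upd p v c≢free w = upd-back p v w c≢free

↝-trans : ∀ {m} {p q r : Pos m} → p ↝ q → q ↝ r → p ↝ r
↝-trans pq qr v = pq v ∘ qr v

freeSet-⊆ : ∀ {m} (p q : Pos m) → p ↝ q → freeSet q ⊆ freeSet p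
freeSet-⊆ p q p↝q = ∈freeSet p ∘ p↝q _ ∘ ∈freeSet⁻ q

nFree-mono : ∀ {m} (p q : Pos m) → p ↝ q → nFree q ≤ nFree p
nFree-mono p q p↝q = p⊆q⇒∣p∣≤∣q∣ (freeSet-⊆ p q p↝q)

nFree-strict : ∀ {m} (p q : Pos m) → p ↝ q → ∀ v → p v ≡ free → q v ≢ free → nFree q < nFree p
nFree-strict p q p↝q v pv qv =
  p⊂q⇒∣p∣<∣q∣ (freeSet-⊆ p q p↝q , v , ∈freeSet p pv , qv ∘ ∈freeSet⁻ q)

nFree≤ : ∀ {m} (p : Pos m) → nFree p ≤ m
nFree≤ p = ∣p∣≤n (freeSet p)

budget : ∀ {x y k} → x < y → y ≤ k → ∃[ k′ ] (k ≡ suc k′ × x ≤ k′)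
budget x<y y≤k with <-≤-trans x<y y≤k
... | s≤s x≤k′ = _ , refl , x≤k′

free-or-full : ∀ {m} (p : Pos m) → ∃[ v ] (p v ≡ free) ⊎ (∀ v → p v ≢ free)
free-or-full p with any? (λ v → isFree (p v) ≟ᵇ true)
... | yes (v , e) = inj₁ (v , isFree-sound (p v) e)
... | no none = inj₂ (λ v vf → none (v , cong isFree vf))

module Rules {m : ℕ} (a : Adj m) where
  open Game a

  not-both : ∀ {p} → DomWins p → StallerWins p → ⊥
  not-both dw (v , sw) with dw v
  ... | inj₁ e = dom≢stal (trans (sym e) (sw v (inj₁ refl)))
  ... | inj₂ (w , vw , e) = dom≢stal (trans (sym e) (sw w (inj₂ vw)))

  Dominated : Pos m → Fin m → Set
  Dominated p v = p v ≡ dom ⊎ ∃[ w ] (a v w ≡ true × p w ≡ dom)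

  isDom? : (c : Cell) → Dec (c ≡ dom)
  isDom? free = no λ ()
  isDom? dom  = yes refl
  isDom? stal = no λ ()

  dominated? : ∀ p v → Dec (Dominated p v)
  dominated? p v = isDom? (p v) ⊎-dec any? (λ w → (a v w ≟ᵇ true) ×-dec isDom? (p w))

  -- On a full board one of the players has won: an undominated vertex and all its
  -- neighbours are Staller's.
  full-board : ∀ p → (∀ v → p v ≢ free) → DomWins p ⊎ StallerWins p
  full-board p full with any? (λ v → ¬? (dominated? p v))
  ... | no none = inj₁ λ v → decidable-stable (dominated? p v) (λ nd → none (v , nd))
  ... | yes (v , nd) = inj₂ (v , staller)
    where
      staller-cell : ∀ w → p w ≢ dom → p w ≡ stal
      staller-cell w nd′ with cell-cases (p w)
      ... | inj₁ f = ⊥-elim (full w f)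
      ... | inj₂ (inj₁ d) = ⊥-elim (nd′ d)
      ... | inj₂ (inj₂ s) = s
      staller : ∀ w → w ≡ v ⊎ a v w ≡ true → p w ≡ stal
      staller w (inj₁ refl) = staller-cell w (nd ∘ inj₁)
      staller w (inj₂ vw) = staller-cell w (λ d → nd (inj₂ (w , vw , d)))

  WinS⇒¬SW : ∀ k {p} → WinS k p → ¬ StallerWins p
  WinS⇒¬SW k (inj₁ dw) = not-both dw
  WinS⇒¬SW k (inj₂ (ns , _)) = ns

  SW-dom-move : ∀ {p} y → p y ≡ free → StallerWins p → StallerWins (upd p y dom)
  SW-dom-move {p} y yf (v , sw) = v , λ w w∈N → upd-keeps p dom yf stal≢free (sw w w∈N)

  DW-stal-move : ∀ {p} y → p y ≡ free → DomWins p → DomWins (upd p y stal)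
  DW-stal-move {p} y yf dw v with dw v
  ... | inj₁ e = inj₁ (upd-keeps p stal yf dom≢free e)
  ... | inj₂ (w , vw , e) = inj₂ (w , vw , upd-keeps p stal yf dom≢free e)

  staller-moves : ∀ k {p} v → p v ≡ free → WinS k p → WinD k (upd p v stal)
  staller-moves k v vf (inj₁ dw) = inj₁ (DW-stal-move v vf dw)
  staller-moves k v vf (inj₂ (_ , reply)) = reply v vf

  -- p ⊑ q : q arises from p by handing some of Staller's vertices back to the board.
  -- Such a q is at least as good for Dominator as p.
  _⊑_ : Pos m → Pos m → Set
  p ⊑ q = ∀ v → q v ≡ p v ⊎ (p v ≡ stal × q v ≡ free)

  ≗⇒⊑ : ∀ {p q} → p ≗ q → p ⊑ q
  ≗⇒⊑ p≗q v = inj₁ (sym (p≗q v))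

  ⊑-upd : ∀ {p q} → p ⊑ q → ∀ v c → upd p v c ⊑ upd q v c
  ⊑-upd p⊑q v c w with w ≟ v
  ... | yes _ = inj₁ refl
  ... | no _ = p⊑q w

  unstal : ∀ {p} y → p y ≡ free → upd p y stal ⊑ p
  unstal y yf w with w ≟ y
  ... | yes refl = inj₂ (refl , yf)
  ... | no _ = inj₁ refl

  dom-⊑ : ∀ {p q} → p ⊑ q → ∀ v → p v ≡ dom → q v ≡ dom
  dom-⊑ p⊑q v e with p⊑q v
  ... | inj₁ e′ = trans e′ e
  ... | inj₂ (s , _) = ⊥-elim (dom≢stal (trans (sym e) s))

  free-⊑ : ∀ {p q} → p ⊑ q → ∀ v → p v ≡ free → q v ≡ free
  free-⊑ p⊑q v e with p⊑q v
  ... | inj₁ e′ = trans e′ e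
  ... | inj₂ (s , _) = ⊥-elim (stal≢free (trans (sym s) e))

  stal-⊑ : ∀ {p q} → p ⊑ q → ∀ v → q v ≡ stal → p v ≡ stal
  stal-⊑ p⊑q v e with p⊑q v
  ... | inj₁ e′ = trans (sym e′) e
  ... | inj₂ (_ , f) = ⊥-elim (stal≢free (trans (sym e) f))

  DW-⊑ : ∀ {p q} → p ⊑ q → DomWins p → DomWins q
  DW-⊑ p⊑q dw v with dw v
  ... | inj₁ e = inj₁ (dom-⊑ p⊑q v e)
  ... | inj₂ (w , vw , e) = inj₂ (w , vw , dom-⊑ p⊑q w e)

  SW-⊑ : ∀ {p q} → p ⊑ q → StallerWins q → StallerWins p
  SW-⊑ p⊑q (v , sw) = v , λ w w∈N → stal-⊑ p⊑q w (sw w w∈N)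

  -- Winning within k moves is preserved by ⊑; moreover a position won by Dominator
  -- with Staller to move is also won with Dominator to move: he can play where
  -- Staller would have played and regard that vertex as an extra Staller vertex.
  mutual
    monoD : ∀ k {p q} → p ⊑ q → WinD k p → WinD k q
    monoD k p⊑q (inj₁ dw) = inj₁ (DW-⊑ p⊑q dw)
    monoD (suc k) p⊑q (inj₂ (ns , v , vf , ws)) =
      inj₂ (ns ∘ SW-⊑ p⊑q , v , free-⊑ p⊑q v vf , monoS k (⊑-upd p⊑q v dom) ws)

    monoS : ∀ k {p q} → p ⊑ q → WinS k p → WinS k q
    monoS k p⊑q (inj₁ dw) = inj₁ (DW-⊑ p⊑q dw)
    monoS k {p} {q} p⊑q (inj₂ (ns , reply)) = inj₂ (ns ∘ SW-⊑ p⊑q , reply′)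
      where
        reply′ : ∀ v → q v ≡ free → WinD k (upd q v stal)
        reply′ v vf with p⊑q v
        ... | inj₁ e = monoD k (⊑-upd p⊑q v stal) (reply v (trans (sym e) vf))
        ... | inj₂ (s , _) = monoD k p⊑q′ (S⇒D k (inj₂ (ns , reply)))
          where
            p⊑q′ : p ⊑ upd q v stal
            p⊑q′ w with w ≟ v
            ... | yes refl = inj₁ (sym s)
            ... | no _ = p⊑q w

    S⇒D : ∀ k {p} → WinS k p → WinD k p
    S⇒D k (inj₁ dw) = inj₁ dw
    S⇒D k {p} (inj₂ (ns , reply)) with free-or-full p
    ... | inj₁ (y , yf) = monoD k (unstal y yf) (reply y yf)
    ... | inj₂ full with full-board p full
    ...   | inj₁ dw = inj₁ dw
    ...   | inj₂ sw = ⊥-elim (ns sw)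

module Prism {n : ℕ} (a : Adj n) where

  A : Adj (n + n)
  A = a □K₂

  L : Bool → Fin n → Fin (n + n)
  L true u = u ↑ˡ n
  L false u = n ↑ʳ u

  adj-layer : ∀ b u w → A (L b u) (L b w) ≡ a u w
  adj-layer true u w rewrite splitAt-↑ˡ n u n | splitAt-↑ˡ n w n = refl
  adj-layer false u w rewrite splitAt-↑ʳ n n u | splitAt-↑ʳ n n w = refl

  ⌊≟⌋-refl : ∀ (u : Fin n) → ⌊ u ≟ u ⌋ ≡ true
  ⌊≟⌋-refl u with u ≟ u
  ... | yes _ = refl
  ... | no u≢u = ⊥-elim (u≢u refl)

  adj-twin : ∀ b u → A (L b u) (L (not b) u) ≡ true
  adj-twin true u rewrite splitAt-↑ˡ n u n | splitAt-↑ʳ n n u = ⌊≟⌋-refl u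
  adj-twin false u rewrite splitAt-↑ʳ n n u | splitAt-↑ˡ n u n = ⌊≟⌋-refl u

  data Layered : Fin (n + n) → Set where
    at : ∀ b u → Layered (L b u)

  layered : ∀ x → Layered x
  layered x with splitAt n x in eq
  ... | inj₁ u = subst Layered (trans (sym (cong (join n n) eq)) (join-splitAt n n x)) (at true u)
  ... | inj₂ u = subst Layered (trans (sym (cong (join n n) eq)) (join-splitAt n n x)) (at false u)

  L-injective : ∀ b b′ {u u′} → L b u ≡ L b′ u′ → b ≡ b′ × u ≡ u′
  L-injective true true e = refl , ↑ˡ-injective n _ _ e
  L-injective false false e = refl , ↑ʳ-injective n _ _ e
  L-injective true false {u} {u′} e
    with trans (sym (splitAt-↑ˡ n u n)) (trans (cong (splitAt n) e) (splitAt-↑ʳ n n u′))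
  ... | ()
  L-injective false true {u} {u′} e
    with trans (sym (splitAt-↑ʳ n n u)) (trans (cong (splitAt n) e) (splitAt-↑ˡ n u′ n))
  ... | ()

  layers-disjoint : ∀ {b c} u v → b ≢ c → L b u ≢ L c v
  layers-disjoint {b} {c} u v b≢c = b≢c ∘ proj₁ ∘ L-injective b c

  b≢not-b : ∀ b → b ≢ not b
  b≢not-b b = not-¬ refl

  π : Bool → Pos (n + n) → Pos n
  π b P u = P (L b u)

  π-same : ∀ b P v c → π b (upd P (L b v) c) ≗ upd (π b P) v c
  π-same b P v c u with u ≟ v
  ... | yes refl = upd-same P (L b v) c
  ... | no u≢v = upd-other P (L b v) c (u≢v ∘ proj₂ ∘ L-injective b b)

  π-other : ∀ {b c} → b ≢ c → ∀ P v d → π c (upd P (L b v) d) ≗ π c P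
  π-other b≢c P v d u = upd-other P _ d (layers-disjoint u v (b≢c ∘ sym))

  both-layers : ∀ {ℓ} (R : Bool → Set ℓ) {b c} → b ≢ c → R b → R c → ∀ d → R d
  both-layers R {true}  {true}  b≢c Rb Rc d     = ⊥-elim (b≢c refl)
  both-layers R {false} {false} b≢c Rb Rc d     = ⊥-elim (b≢c refl)
  both-layers R {true}  {false} b≢c Rb Rc true  = Rb
  both-layers R {true}  {false} b≢c Rb Rc false = Rc
  both-layers R {false} {true}  b≢c Rb Rc true  = Rc
  both-layers R {false} {true}  b≢c Rb Rc false = Rb

  DW-layers : ∀ P → (∀ b → Game.DomWins a (π b P)) → Game.DomWins A P
  DW-layers P dw x with layered x
  ... | at b u with dw b u
  ...   | inj₁ e = inj₁ e
  ...   | inj₂ (w , uw , e) = inj₂ (L b w , trans (adj-layer b u w) uw , e)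

  SW-layer : ∀ P → Game.StallerWins A P → ∃[ b ] Game.StallerWins a (π b P)
  SW-layer P (x , sw) with layered x
  ... | at b u = b , u , λ where
    w (inj₁ refl) → sw (L b u) (inj₁ refl)
    w (inj₂ uw) → sw (L b w) (inj₂ (trans (adj-layer b u w) uw))

-- The invariant is that the
-- twin of every Staller vertex is Dominator's; once layer true has no free vertex,
-- every twin pair contains a Dominator vertex, which dominates both. Each Dominator
-- move claims a free vertex of layer true, so at most n moves are needed.
module Pairing {n : ℕ} (a : Adj n) where
  open Prism a
  open Game A
  open Rules A using (SW-dom-move)

  twin-kept : ∀ P b u d → upd P (L b u) d (L (not b) u) ≡ P (L (not b) u)
  twin-kept P b u d = π-other (b≢not-b b) P u d u

  Paired : Pos (n + n) → Set
  Paired P = ∀ b u → P (L b u) ≡ stal → P (L (not b) u) ≡ dom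

  μ : Pos (n + n) → ℕ
  μ P = nFree (π true P)

  μ-mono : ∀ P Q → P ↝ Q → μ Q ≤ μ P
  μ-mono P Q P↝Q = nFree-mono (π true P) (π true Q) (λ u → P↝Q (L true u))

  μ-strict : ∀ P Q → P ↝ Q → ∀ u → P (L true u) ≡ free → Q (L true u) ≢ free → μ Q < μ P
  μ-strict P Q P↝Q = nFree-strict (π true P) (π true Q) (λ u → P↝Q (L true u))

  -- Staller cannot own a closed neighbourhood: it contains a twin pair.
  Paired⇒¬SW : ∀ {P} → Paired P → ¬ StallerWins P
  Paired⇒¬SW {P} pr (x , sw) with layered x
  ... | at b u = dom≢stal (trans (sym (pr b u (sw _ (inj₁ refl)))) (sw _ (inj₂ (adj-twin b u))))

  twin-not-stal : ∀ P b u → Paired P → P (L b u) ≡ free → P (L (not b) u) ≢ stal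
  twin-not-stal P b u pr xf ts =
    dom≢free (trans (sym (subst (λ c → P (L c u) ≡ dom) (not-involutive b) (pr (not b) u ts))) xf)

  -- With layer true full, every pair contains a Dominator vertex.
  Paired⇒DW : ∀ {P} → Paired P → (∀ u → P (L true u) ≢ free) → DomWins P
  Paired⇒DW {P} pr full x with layered x
  ... | at b u = dominated b pair-dom
    where
      pair-dom : P (L true u) ≡ dom ⊎ P (L false u) ≡ dom
      pair-dom with cell-cases (P (L true u))
      ... | inj₁ f = ⊥-elim (full u f)
      ... | inj₂ (inj₁ d) = inj₁ d
      ... | inj₂ (inj₂ s) = inj₂ (pr true u s)
      dominated : ∀ b → P (L true u) ≡ dom ⊎ P (L false u) ≡ dom →
                  P (L b u) ≡ dom ⊎ ∃[ w ] (A (L b u) w ≡ true × P w ≡ dom)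
      dominated true (inj₁ d) = inj₁ d
      dominated true (inj₂ d) = inj₂ (_ , adj-twin true u , d)
      dominated false (inj₁ d) = inj₂ (_ , adj-twin false u , d)
      dominated false (inj₂ d) = inj₁ d

  Paired-dom : ∀ P x → P x ≡ free → Paired P → Paired (upd P x dom)
  Paired-dom P x xf pr b u s =
    upd-keeps P dom xf dom≢free (pr b u (upd-back P x (L b u) (λ ()) s))

  Paired-stal : ∀ P b u → P (L b u) ≡ free → P (L (not b) u) ≡ dom → Paired P →
                Paired (upd P (L b u) stal)
  Paired-stal P b u xf td pr b′ u′ s with upd-cell P (L b u) (L b′ u′) s
  ... | inj₂ s′ = upd-keeps P stal xf dom≢free (pr b′ u′ s′)
  ... | inj₁ e with L-injective b′ b e
  ...   | refl , refl = upd-keeps P stal xf dom≢free td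

  Paired-reply : ∀ P b u → P (L b u) ≡ free → P (L (not b) u) ≡ free → Paired P →
                 Paired (upd (upd P (L b u) stal) (L (not b) u) dom)
  Paired-reply P b u xf tf pr b′ u′ s
    with upd-cell P (L b u) (L b′ u′) (upd-back (upd P (L b u) stal) (L (not b) u) (L b′ u′) (λ ()) s)
  ... | inj₂ s′ =
    upd-keeps (upd P (L b u) stal) dom tf′ dom≢free (upd-keeps P stal xf dom≢free (pr b′ u′ s′))
    where tf′ : upd P (L b u) stal (L (not b) u) ≡ free
          tf′ = trans (twin-kept P b u stal) tf
  ... | inj₁ e with L-injective b′ b e
  ...   | refl , refl = upd-same (upd P (L b u) stal) (L (not b) u) dom

  μ-claim-true : ∀ P u → P (L true u) ≡ free → μ (upd P (L true u) dom) < μ P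
  μ-claim-true P u uf =
    μ-strict P _ (↝-upd P _ dom≢free) u uf (dom≢free ∘ trans (sym (upd-same P _ dom)))

  μ-claim-pair : ∀ P b u → P (L b u) ≡ free → P (L (not b) u) ≡ free →
                 μ (upd (upd P (L b u) stal) (L (not b) u) dom) < μ P
  μ-claim-pair P b u xf tf =
    μ-strict P P″ (↝-trans (↝-upd P _ stal≢free) (↝-upd P′ _ dom≢free)) u
      (both-layers (λ c → P (L c u) ≡ free) (b≢not-b b) xf tf true)
      (both-layers (λ c → P″ (L c u) ≢ free) (b≢not-b b) stal-kept dom-claimed true)
    where
      P′ P″ : Pos (n + n)
      P′ = upd P (L b u) stal
      P″ = upd P′ (L (not b) u) dom
      tf′ : P′ (L (not b) u) ≡ free
      tf′ = trans (twin-kept P b u stal) tf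
      stal-kept : P″ (L b u) ≢ free
      stal-kept = stal≢free ∘ trans (sym (upd-keeps P′ dom tf′ stal≢free (upd-same P (L b u) stal)))
      dom-claimed : P″ (L (not b) u) ≢ free
      dom-claimed = dom≢free ∘ trans (sym (upd-same P′ (L (not b) u) dom))

  mutual
    pairing-D : ∀ k P → Paired P → μ P ≤ k → WinD k P
    pairing-D k P pr μ≤k with free-or-full (π true P)
    ... | inj₂ full = inj₁ (Paired⇒DW pr full)
    ... | inj₁ (u , uf) with budget (μ-claim-true P u uf) μ≤k
    ...   | k′ , refl , μ′≤k′ =
      inj₂ (Paired⇒¬SW pr , L true u , uf , pairing-S k′ _ (Paired-dom P (L true u) uf pr) μ′≤k′)

    pairing-S : ∀ k P → Paired P → μ P ≤ k → WinS k P
    pairing-S k P pr μ≤k = inj₂ (Paired⇒¬SW pr , reply)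
      where
        reply : ∀ x → P x ≡ free → WinD k (upd P x stal)
        reply x xf with layered x
        ... | at b u = respond k P pr μ≤k b u xf

    respond : ∀ k P → Paired P → μ P ≤ k → ∀ b u → P (L b u) ≡ free → WinD k (upd P (L b u) stal)
    respond k P pr μ≤k b u xf with cell-cases (P (L (not b) u))
    ... | inj₂ (inj₂ ts) = ⊥-elim (twin-not-stal P b u pr xf ts)
    ... | inj₂ (inj₁ td) =
      pairing-D k _ (Paired-stal P b u xf td pr) (≤-trans (μ-mono P _ (↝-upd P _ stal≢free)) μ≤k)
    ... | inj₁ tf with budget (μ-claim-pair P b u xf tf) μ≤k
    ...   | k′ , refl , μ″≤k′ =
      inj₂ ((λ sw → Paired⇒¬SW paired″ (SW-dom-move _ tf′ sw)) , L (not b) u , tf′ ,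
            pairing-S k′ _ paired″ μ″≤k′)
      where
        tf′ : upd P (L b u) stal (L (not b) u) ≡ free
        tf′ = trans (twin-kept P b u stal) tf
        paired″ : Paired (upd (upd P (L b u) stal) (L (not b) u) dom)
        paired″ = Paired-reply P b u xf tf pr

-- Each
-- layer is dominated by Dominator's vertices in it, so G □ K₂ is dominated after
-- at most the sum of the two budgets. The invariant pairs a D-game position on one
-- layer with an S-game position on the other (Dominator to move), or two S-game
-- positions (Staller to move).
module Layerwise {n : ℕ} (a : Adj n) where
  open Prism a
  open Game A using (WinD; WinS; StallerWins)
  module G = Game a
  module R = Rules a

  ⊑-same : ∀ b P v d → upd (π b P) v d R.⊑ π b (upd P (L b v) d)
  ⊑-same b P v d = R.≗⇒⊑ (λ u → sym (π-same b P v d u))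

  ⊑-other : ∀ {b c} → b ≢ c → ∀ P v d → π c P R.⊑ π c (upd P (L b v) d)
  ⊑-other b≢c P v d = R.≗⇒⊑ (λ u → sym (π-other b≢c P v d u))

  ¬SW-layers : ∀ {b c} P → b ≢ c → ¬ G.StallerWins (π b P) → ¬ G.StallerWins (π c P) → ¬ StallerWins P
  ¬SW-layers P b≢c nb nc sw with SW-layer P sw
  ... | d , swd = both-layers (λ d → ¬ G.StallerWins (π d P)) b≢c nb nc d swd

  -- If layer b is already dominated, Dominator plays on layer c instead.
  mutual
    layers-D : ∀ k {b c} P → b ≢ c → ∀ x y →
               G.WinD x (π b P) → G.WinS y (π c P) → x + y ≤ k → WinD k P
    layers-D k P b≢c x y (inj₁ dw) wy le with R.S⇒D y wy
    ... | inj₁ dw′ = inj₁ (DW-layers P (both-layers (λ d → G.DomWins (π d P)) b≢c dw dw′))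
    layers-D k P b≢c x zero (inj₁ dw) wy le | inj₂ (_ , ())
    layers-D k {b} {c} P b≢c x (suc y) (inj₁ dw) wy le | inj₂ (ns , v , vf , wy′)
      with budget (m≤n+m (suc y) x) le
    ... | k′ , refl , y≤k′ =
      inj₂ (¬SW-layers P b≢c (R.not-both dw) ns , L c v , vf ,
            layers-S k′ (upd P (L c v) dom) b≢c 0 y (inj₁ (R.DW-⊑ (⊑-other (b≢c ∘ sym) P v dom) dw))
                                                  (R.monoS y (⊑-same c P v dom) wy′) y≤k′)
    layers-D (suc k) {b} P b≢c (suc x) y (inj₂ (ns , v , vf , wx′)) wy (s≤s le) =
      inj₂ (¬SW-layers P b≢c ns (R.WinS⇒¬SW y wy) , L b v , vf ,
            layers-S k (upd P (L b v) dom) b≢c x y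
              (R.monoS x (⊑-same b P v dom) wx′) (R.monoS y (⊑-other b≢c P v dom) wy) le)

    layers-S : ∀ k {b c} P → b ≢ c → ∀ x y →
               G.WinS x (π b P) → G.WinS y (π c P) → x + y ≤ k → WinS k P
    layers-S k {b} {c} P b≢c x y wx wy le =
      inj₂ (¬SW-layers P b≢c (R.WinS⇒¬SW x wx) (R.WinS⇒¬SW y wy) , reply)
      where
        reply : ∀ z → P z ≡ free → Game.WinD A k (upd P z stal)
        reply z zf with layered z
        ... | at d u with both-layers (λ d → d ≡ b ⊎ d ≡ c) b≢c (inj₁ refl) (inj₂ refl) d
        ...   | inj₁ refl = answer k P b≢c x y wx wy le u zf
        ...   | inj₂ refl = answer k P (b≢c ∘ sym) y x wy wx (subst (_≤ k) (+-comm x y) le) u zf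

    -- Staller claims  L b u : Dominator's strategy on layer b now faces a D-game.
    answer : ∀ k {b c} P → b ≢ c → ∀ x y → G.WinS x (π b P) → G.WinS y (π c P) → x + y ≤ k →
             ∀ u → P (L b u) ≡ free → WinD k (upd P (L b u) stal)
    answer k {b} P b≢c x y wx wy le u uf =
      layers-D k (upd P (L b u) stal) b≢c x y
        (R.monoD x (⊑-same b P u stal) (R.staller-moves x u uf wx))
        (R.monoS y (⊑-other b≢c P u stal) wy) le

least-budget : ∀ {W : ℕ → Set} {h k} → (∀ k → k < h → ¬ W k) → W k → h ≤ k
least-budget minimal w = ≮⇒≥ (λ k<h → minimal _ k<h w)

theorem3 : (n : ℕ) (G : SimpleGraph n) →
    (Game.WinD (adj G □K₂) n start × Game.WinS (adj G □K₂) n start)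
    × (∀ g g′ → IsγMB (adj G) g → IsγMB′ (adj G) g′ →
         (∀ h → IsγMB (adj G □K₂) h → h ≤ (g + g′) ⊓ n)
         × (∀ h → IsγMB′ (adj G □K₂) h → h ≤ (2 * g′) ⊓ n))
theorem3 n G = (pairing-D-wins , pairing-S-wins) , λ g g′ (wg , _) (wg′ , _) →
    (λ h (_ , minimal) → ⊓-glb
       (least-budget minimal (Layerwise.layers-D a (g + g′) start true≢false g g′ wg wg′ ≤-refl))
       (least-budget minimal pairing-D-wins))
  , (λ h (_ , minimal) → ⊓-glb
       (least-budget minimal (Layerwise.layers-S a (2 * g′) start true≢false g′ g′ wg′ wg′ (twice g′)))
       (least-budget minimal pairing-S-wins))
  where
    a : Adj n
    a = adj G
    true≢false : true ≢ false
    true≢false ()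
    twice : ∀ x → x + x ≤ 2 * x
    twice x = ≤-reflexive (cong (x +_) (sym (+-identityʳ x)))
    start-paired : Pairing.Paired a start
    start-paired b u ()
    pairing-D-wins : Game.WinD (a □K₂) n start
    pairing-D-wins = Pairing.pairing-D a n start start-paired (nFree≤ _)
    pairing-S-wins : Game.WinS (a □K₂) n start
    pairing-S-wins = Pairing.pairing-S a n start start-paired (nFree≤ _)
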